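{- Let $(F,L,l)$ be an instance of the 2-ASLASAT problem. Then every culprit set $S$ of $(F,L,l)$ satisfies $|S|\ge SepSize(F,\neg L,\neg l)$; in particular the size of a smallest culprit set of $(F,L,l)$ is at least $SepSize(F,\neg L,\neg l)$.
   Context: A literal is a Boolean variable or its negation; $\neg$ denotes negation, and for a set $L$ of literals $\neg L=\{\neg l': l'\in L\}$. $Var(\cdot)$ denotes the set of variables. A 2-CNF formula $F$ is a conjunction of clauses each consisting of exactly two literals (a one-literal clause $(l)$ is written $(l\vee l)$; $(l_1\vee l_2)$ and $(l_2\vee l_1)$ are the same clause), with pairwise distinct clauses; $Clauses(F)$ is its set of clauses and $F\setminus S$ is the formula of clauses of $F$ not in $S$. A set of literals is non-contradictory if it contains no literal and its negation. A satisfying assignment of $F$ is a non-contradictory set $P$ of literals with $Var(P)=Var(F)$ such that each clause of $F$ contains a literal of $P$. $SWRT(F,L)$ means $F$ has a satisfying assignment $P$ with $P\cap \neg L=\emptyset$. An instance of the 2-ASLASAT problem is a triple $(F,L,l)$ with $F$ such a 2-CNF formula, $L$ a non-contradictory set of literals with $SWRT(F,L)$ true, and $l$ a literal with $Var(l)\notin Var(L)$. A culprit set of $(F,L,l)$ is $S\subseteq Clauses(F)$ with $SWRT(F\setminus S,L\cup\{l\})$ true. A walk of $F$ is a nonempty sequence $(C_1,\dots,C_q)$ of (not necessarily distinct) clauses of $F$ where in each entry one literal is designated first and the other second, such that for $i<q$ the second literal of $C_i$ is the negation of the first literal of $C_{i+1}$; it is from the first literal of $C_1$ to the second literal of $C_q$,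 and from a set $M$ if its first literal lies in $M$. A path is a walk whose clauses are pairwise distinct. For a set $M$ of literals and a literal $l_y$, a separator of $F$ w.r.t. $M$ and $l_y$ is a set $SC$ of clauses of $F$ such that $F\setminus SC$ has no path from $M$ to $l_y$; $SepSize(F,M,l_y)$ is the minimum size of such a separator. -}

module Defs where

open import Data.Nat using (ℕ; _≤_)
open import Data.Bool using (Bool; true; false; not)
open import Data.Product using (_×_; _,_; Σ; ∃; proj₁; proj₂)
open import Data.Sum using (_⊎_)
open import Data.List using (List; []; _∷_; length; filter)
open import Data.List.Membership.Propositional using (_∈_)
open import Data.List.Relation.Unary.Any using (Any)
open import Data.List.Relation.Unary.All using (All)
open import Data.List.Relation.Unary.AllPairs using (AllPairs)
open import Relation.Binary.PropositionalEquality using (_≡_)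
open import Relation.Nullary using (¬_; Dec; yes; no)
open import Relation.Nullary.Decidable using (_⊎-dec_; ¬?)
open import Data.List.Relation.Unary.Any using (any?)

-- A literal: variable (a natural number) with a polarity (true = positive).
record Literal : Set where
  constructor lit
  field
    var : ℕ
    pos : Bool
open Literal public

negL : Literal → Literal
negL (lit x b) = lit x (not b)

_≟L_ : (a b : Literal) → Dec (a ≡ b)
lit x b ≟L lit y c with x Data.Nat.≟ y | b Data.Bool.≟ c
  where import Data.Nat; import Data.Bool
... | yes Relation.Binary.PropositionalEquality.refl | yes Relation.Binary.PropositionalEquality.refl = yes Relation.Binary.PropositionalEquality.refl
... | no p | _ = no λ { Relation.Binary.PropositionalEquality.refl → p Relation.Binary.PropositionalEquality.refl }
... | yes _ | no q = no λ { Relation.Binary.PropositionalEquality.refl → q Relation.Binary.PropositionalEquality.refl }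

-- A clause (l₁ ∨ l₂) with exactly two literals; (l ∨ l) is a one-literal clause.
Clause : Set
Clause = Literal × Literal

_≈C_ : Clause → Clause → Set
(a , b) ≈C (c , d) = ((a ≡ c) × (b ≡ d)) ⊎ ((a ≡ d) × (b ≡ c))

_≈C?_ : (C D : Clause) → Dec (C ≈C D)
(a , b) ≈C? (c , d) = ((a ≟L c) ×-dec (b ≟L d)) ⊎-dec ((a ≟L d) ×-dec (b ≟L c))
  where open import Relation.Nullary.Decidable using (_×-dec_)

Formula : Set
Formula = List Clause

_∈C_ : Clause → Formula → Set
C ∈C F = Any (C ≈C_) F

_∈C?_ : (C : Clause) → (F : Formula) → Dec (C ∈C F)
C ∈C? F = any? (C ≈C?_) F

WellFormed : Formula → Set
WellFormed F = AllPairs (λ C D → ¬ (C ≈C D)) F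

ClauseSubset : Formula → List Clause → Set
ClauseSubset F S = AllPairs (λ C D → ¬ (C ≈C D)) S × All (λ C → C ∈C F) S

_∖_ : Formula → List Clause → Formula
F ∖ S = filter (λ C → ¬? (C ∈C? S)) F

VarOf : Formula → ℕ → Set
VarOf F x = Any (λ C → (var (proj₁ C) ≡ x) ⊎ (var (proj₂ C) ≡ x)) F

VarOfL : List Literal → ℕ → Set
VarOfL L x = Any (λ l → var l ≡ x) L

NonContradictory : List Literal → Set
NonContradictory P = ∀ l → l ∈ P → ¬ (negL l ∈ P)

Satisfies : List Literal → Formula → Set
Satisfies P F =
  NonContradictory P
  × (∀ x → VarOfL P x → VarOf F x)
  × (∀ x → VarOf F x → VarOfL P x)
  × All (λ C → (proj₁ C ∈ P) ⊎ (proj₂ C ∈ P)) F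

SWRT : Formula → List Literal → Set
SWRT F L = Σ (List Literal) λ P → Satisfies P F × (∀ l → l ∈ P → ¬ (negL l ∈ L))

IsInstance : Formula → List Literal → Literal → Set
IsInstance F L l = WellFormed F × NonContradictory L × SWRT F L × ¬ VarOfL L (var l)

IsCulprit : Formula → List Literal → Literal → List Clause → Set
IsCulprit F L l S = ClauseSubset F S × SWRT (F ∖ S) (l ∷ L)

-- Walks: a walk entry is an oriented clause (first literal, second literal).
-- Chain ws : consecutive entries satisfy second(Cᵢ) = ¬ first(Cᵢ₊₁).
Chain : List Clause → Set
Chain [] = Data.Unit.⊤
  where import Data.Unit
Chain (_ ∷ []) = Data.Unit.⊤
  where import Data.Unit
Chain ((a , b) ∷ (c , d) ∷ ws) = (b ≡ negL c) × Chain ((c , d) ∷ ws)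

lastSnd : Clause → List Clause → Literal
lastSnd (a , b) [] = b
lastSnd _ (w ∷ ws) = lastSnd w ws

IsPath : Formula → List Literal → Literal → Clause → List Clause → Set
IsPath F M y w ws =
  All (λ C → C ∈C F) (w ∷ ws)
  × Chain (w ∷ ws)
  × AllPairs (λ C D → ¬ (C ≈C D)) (w ∷ ws)
  × (proj₁ w ∈ M)
  × (lastSnd w ws ≡ y)

IsSeparator : Formula → List Literal → Literal → List Clause → Set
IsSeparator F M y SC =
  ClauseSubset F SC × (∀ w ws → ¬ IsPath (F ∖ SC) M y w ws)

IsSepSize : Formula → List Literal → Literal → ℕ → Set
IsSepSize F M y k =
  (Σ (List Clause) λ SC → IsSeparator F M y SC × length SC ≡ k)
  × (∀ SC → IsSeparator F M y SC → k ≤ length SC)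

negSet : List Literal → List Literal
negSet = Data.List.map negL
  where import Data.List

module Submission where

-- A culprit set S leaves a formula F ∖ S with a satisfying assignment P
-- avoiding ¬(l ∷ L).  Reading each clause (a ∨ b) as the implication ¬a ⇒ b, a
-- walk is a chain of implications: if its first literal is false under P, then
-- every clause forces the next literal to be true, so its last literal is true.
-- A walk from ¬L starts at a literal that P avoids; a walk ending at ¬l would
-- make ¬l true, again contradicting that P avoids ¬(l ∷ L).  Hence S is itself
-- a separator of F w.r.t. ¬L and ¬l, and minimality of SepSize bounds |S|.

open import Defs
open import Data.Nat using (ℕ; _≤_)
open import Data.List using (List; length; []; _∷_)
open import Data.Product using (_,_; proj₁; proj₂)
open import Data.Sum using (_⊎_; inj₁; inj₂)
open import Data.Empty using (⊥-elim)
open import Data.List.Relation.Unary.Any using (here; there)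
open import Data.List.Relation.Unary.All using (All; []; _∷_)
import Data.List.Relation.Unary.All as All
open import Data.List.Membership.Propositional using (_∈_)
open import Data.List.Membership.Propositional.Properties using (∈-map⁻)
open import Relation.Binary.PropositionalEquality using (_≡_; refl; subst; sym; cong)
open import Relation.Nullary using (¬_)
open import Data.Bool.Properties using (not-involutive)

negL-involutive : ∀ m → negL (negL m) ≡ m
negL-involutive (lit x b) = cong (lit x) (not-involutive b)

SatisfiedBy : List Literal → Clause → Set
SatisfiedBy P C = (proj₁ C ∈ P) ⊎ (proj₂ C ∈ P)

satisfied-∈C : ∀ {P C G} → All (SatisfiedBy P) G → C ∈C G → SatisfiedBy P C
satisfied-∈C (s ∷ _)        (here (inj₁ (refl , refl))) = s
satisfied-∈C (inj₁ x ∷ _)   (here (inj₂ (refl , refl))) = inj₂ x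
satisfied-∈C (inj₂ x ∷ _)   (here (inj₂ (refl , refl))) = inj₁ x
satisfied-∈C (_ ∷ sat)      (there m)                   = satisfied-∈C sat m

walk-propagates : ∀ {P} → NonContradictory P →
  (w : Clause) (ws : List Clause) → All (SatisfiedBy P) (w ∷ ws) → Chain (w ∷ ws) →
  ¬ (proj₁ w ∈ P) → lastSnd w ws ∈ P
walk-propagates nc (a , b) [] (inj₁ a∈P ∷ []) _ a∉P = ⊥-elim (a∉P a∈P)
walk-propagates nc (a , b) [] (inj₂ b∈P ∷ []) _ _   = b∈P
walk-propagates nc (a , b) (w ∷ ws) (inj₁ a∈P ∷ _) _ a∉P = ⊥-elim (a∉P a∈P)
walk-propagates {P} nc (a , b) ((c , d) ∷ ws) (inj₂ b∈P ∷ sat) (b≡¬c , chain) _ =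
  walk-propagates nc (c , d) ws sat chain c∉P
  where
  -- b = ¬c is true, so c is false.
  c∉P : ¬ (c ∈ P)
  c∉P c∈P = nc c c∈P (subst (_∈ P) b≡¬c b∈P)

avoids-negSet : ∀ {P L a} → (∀ x → x ∈ P → ¬ (negL x ∈ L)) → a ∈ negSet L → ¬ (a ∈ P)
avoids-negSet {L = L} avoid a∈¬L a∈P with ∈-map⁻ negL a∈¬L
... | m , m∈L , refl = avoid (negL m) a∈P (subst (_∈ L) (sym (negL-involutive m)) m∈L)

-- A satisfying assignment of G avoiding ¬L rules out every path of G from ¬L
-- to a literal of ¬L: its first literal is false, hence its last is true.
sat-no-path : ∀ {G L y} → SWRT G L → y ∈ negSet L →
  ∀ w ws → ¬ IsPath G (negSet L) y w ws
sat-no-path (P , (nc , _ , _ , sat) , avoid) y∈¬L w ws (w∈G , chain , _ , start , end) =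
  avoids-negSet avoid y∈¬L (subst (_∈ P) end lastTrue)
  where
  lastTrue : lastSnd w ws ∈ P
  lastTrue = walk-propagates nc w ws (All.map (satisfied-∈C sat) w∈G) chain
                             (avoids-negSet avoid start)

culprit-separates : ∀ {F L l S} → IsCulprit F L l S → IsSeparator F (negSet L) (negL l) S
culprit-separates (S⊆F , swrt) =
  S⊆F , λ w ws (w∈G , chain , distinct , start , end) →
    sat-no-path swrt (here refl) w ws (w∈G , chain , distinct , there start , end)

corollary1 : (F : Formula) (L : List Literal) (l : Literal) → IsInstance F L l →
    (S : List Clause) → IsCulprit F L l S →
    (k : ℕ) → IsSepSize F (negSet L) (negL l) k → k ≤ length S
corollary1 F L l _ S culprit k (_ , minimal) = minimal S (culprit-separates culprit)
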